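{- Let $\mathcal{Z}$ be a zero-set and $a,b$ positive integers. Let $k$ be the smallest positive integer such that $ai+bj<kab$ for all $(i,j)\in\mathcal{Z}$, and let $(i_0,j_0)\in\mathcal{Z}$ be a point with $(k-1)ab\le ai_0+bj_0$. Then $\mu_{\mathrm{en}}(\mathcal{Z})\ge\min\left(\left\lceil\frac{i_0+1}{b}\right\rceil,\left\lceil\frac{j_0+1}{a}\right\rceil\right)$.
   Context: $\mathbb{Z}_+=\{0,1,2,\dots\}$, $\mathbb{N}=\{1,2,\dots\}$. For $a,b\in\mathbb{N}$, $R_{a,b}=([0,a-1]\times[0,b-1])\cap\mathbb{Z}_+^2$; a zero-set is a union of $R_{a,b}$ over a finite $\mathcal{I}\subseteq\mathbb{N}^2$. For $x\in\mathbb{Z}_+^2$ and $A\subseteq\mathbb{Z}_+^2$, $\mathtt{row}(x,A)$, $\mathtt{col}(x,A)$ are the numbers of points of $A$ on the horizontal and vertical lines through $x$. Enhanced dynamics: enhancements $\vec r=(r_0,r_1,\dots)$, $\vec c=(c_0,c_1,\dots)$ are weakly decreasing sequences of nonnegative integers; $\mathcal{T}_{\mathrm{en}}(A)=A\cup\{(i,j):(\mathtt{row}((i,j),A)+r_j,\mathtt{col}((i,j),A)+c_i)\notin\mathcal{Z}\}$; $(\vec r,\vec c)$ spans for $\mathcal{Z}$ if $\bigcup_t\mathcal{T}_{\mathrm{en}}^t(\emptyset)=\mathbb{Z}_+^2$; $\tau_{\mathrm{en}}(\mathcal{Z},\vec r,\vec c)=\inf\{t\in\mathbb{N}:\mathcal{T}_{\mathrm{en}}^t(\emptyset)=\mathbb{Z}_+^2\}$;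 $\mu_{\mathrm{en}}(\mathcal{Z})$ is the maximum of $\tau_{\mathrm{en}}$ over spanning pairs with finite support. -}

module Defs where

open import Data.Nat using (ℕ; zero; suc; _+_; _*_; _∸_; _≤_; _<_; NonZero)
open import Data.Nat.DivMod using (_/_)
open import Data.Fin using (Fin)
open import Data.Product using (Σ; ∃; _×_; _,_)
open import Data.Sum using (_⊎_)
open import Data.Empty using (⊥)
open import Data.List using (List)
open import Data.List.Relation.Unary.Any using (Any)
open import Function.Definitions using (Injective)
open import Relation.Binary.PropositionalEquality using (_≡_)
open import Relation.Nullary using (¬_)

-- Points of Z+^2 are pairs (i , j) of naturals; i is the first (column index)
-- coordinate, j the second (row index) coordinate.

-- A zero-set is given by its finite index set I ⊆ ℕ², as a list of pairs
-- (a , b) (positivity of entries is a separate hypothesis).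
-- (i , j) ∈ Z  iff  (i , j) ∈ R_{a,b} for some (a , b) ∈ I,
-- i.e. i ≤ a - 1 and j ≤ b - 1.
InZ : List (ℕ × ℕ) → ℕ → ℕ → Set
InZ I i j = Any (λ ab → (i < Data.Product.proj₁ ab) × (j < Data.Product.proj₂ ab)) I
  where import Data.Product

Subset² : Set₁
Subset² = ℕ → ℕ → Set

RowAtLeast : Subset² → ℕ → ℕ → Set
RowAtLeast A j m = Σ (Fin m → ℕ) λ f → Injective _≡_ _≡_ f × (∀ k → A (f k) j)

ColAtLeast : Subset² → ℕ → ℕ → Set
ColAtLeast A i m = Σ (Fin m → ℕ) λ f → Injective _≡_ _≡_ f × (∀ k → A i (f k))

-- (row((i,j),A) + r_j , col((i,j),A) + c_i) ∈ Z, where the counts may be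
-- infinite.  For a rectangle R_{a,b}:
--   row + r_j < a   iff   row < a ∸ r_j   iff   ¬ (A has ≥ a ∸ r_j points on the row)
-- (an infinite count is never below a finite bound).
EnInZ : List (ℕ × ℕ) → (ℕ → ℕ) → (ℕ → ℕ) → Subset² → ℕ → ℕ → Set
EnInZ I r c A i j =
  Any (λ ab → ¬ RowAtLeast A j (Data.Product.proj₁ ab ∸ r j)
            × ¬ ColAtLeast A i (Data.Product.proj₂ ab ∸ c i)) I
  where import Data.Product

Ten : List (ℕ × ℕ) → (ℕ → ℕ) → (ℕ → ℕ) → Subset² → Subset²
Ten I r c A i j = A i j ⊎ ¬ EnInZ I r c A i j

Occ : List (ℕ × ℕ) → (ℕ → ℕ) → (ℕ → ℕ) → ℕ → Subset²
Occ I r c zero    i j = ⊥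
Occ I r c (suc t) i j = Ten I r c (Occ I r c t) i j

WeaklyDecreasing : (ℕ → ℕ) → Set
WeaklyDecreasing r = ∀ n → r (suc n) ≤ r n

FiniteSupport : (ℕ → ℕ) → Set
FiniteSupport r = ∃ λ N → ∀ n → N ≤ n → r n ≡ 0

Spans : List (ℕ × ℕ) → (ℕ → ℕ) → (ℕ → ℕ) → Set
Spans I r c = ∀ i j → ∃ λ t → Occ I r c t i j

-- τ_en(Z, r, c) ≥ m : T_en^t(∅) ≠ Z+^2 for every t ∈ ℕ with 1 ≤ t < m.
TauAtLeast : List (ℕ × ℕ) → (ℕ → ℕ) → (ℕ → ℕ) → ℕ → Set
TauAtLeast I r c m = ∀ t → 1 ≤ t → t < m → ¬ (∀ i j → Occ I r c t i j)

-- μ_en(Z) ≥ m : some spanning pair with finite support has τ_en ≥ m.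
MuAtLeast : List (ℕ × ℕ) → ℕ → Set
MuAtLeast I m =
  Σ (ℕ → ℕ) λ r → Σ (ℕ → ℕ) λ c →
    WeaklyDecreasing r × WeaklyDecreasing c ×
    FiniteSupport r × FiniteSupport c ×
    Spans I r c × TauAtLeast I r c m

ceilDiv : ℕ → (b : ℕ) → .{{NonZero b}} → ℕ
ceilDiv n b = (n + (b ∸ 1)) / b

PositiveIndex : List (ℕ × ℕ) → Set
PositiveIndex I = Data.List.Relation.Unary.All.All (λ ab → (1 ≤ Data.Product.proj₁ ab) × (1 ≤ Data.Product.proj₂ ab)) I
  where import Data.Product
        import Data.List.Relation.Unary.All

module Submission where

-- We exhibit the explicit "staircase" enhancements
--     r_j = (i₀ + b) ∸ b·⌊j/a⌋ ,    c_i = (j₀ + a) ∸ a·⌊i/b⌋ ,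
-- which are weakly decreasing with finite support, and trap T_en^t(∅)
-- between two regions.
--  * Confinement: while t·b ≤ i₀ and t·a ≤ j₀, every occupied point has
--    i < t·b or j < t·a.  Outside this L-shape a point sees fewer than t·b
--    points on its row and t·a on its column, and after adding the
--    enhancements these counts still lie in the rectangle of Z containing
--    (i₀ , j₀).  So (t·b , t·a) is empty at every time 1 ≤ t < M.
--  * Filling: every point of level ⌊i/b⌋ + ⌊j/a⌋ < t is occupied at time t.
--    At such a point the enhanced counts (x , y) satisfy
--    a·x + b·y ≥ a(i₀+b) + b(j₀+a) ≥ k·a·b, a weight no point of Z attains.
--    So the pair spans.

open import Defs
open import Data.Nat using (ℕ; zero; suc; _+_; _*_; _∸_; _≤_; _<_; _⊓_; NonZero; s≤s; s≤s⁻¹; _≤?_; _<?_; >-nonZero⁻¹)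
open import Data.Nat.Properties
open import Data.Nat.DivMod using (_/_; m/n*n≤m; m*n/n≡m; /-monoˡ-≤; m<n*o⇒m/o<n)
open import Data.Nat.Tactic.RingSolver using (solve-∀)
open import Data.Fin using (Fin; toℕ; fromℕ<)
open import Data.Fin.Properties using (injective⇒≤; toℕ-fromℕ<; toℕ<n; toℕ-injective)
open import Data.Product using (_×_; _,_; proj₁; proj₂)
open import Data.Sum using (_⊎_; inj₁; inj₂; [_,_]′)
open import Data.Empty using (⊥-elim)
open import Data.List using (List)
open import Data.List.Relation.Unary.Any as Any using ()
open import Relation.Binary.PropositionalEquality
open import Relation.Nullary using (¬_; yes; no)
open import Function.Definitions using (Injective)

<ceilDiv⇒*≤ : (n b t : ℕ) .{{_ : NonZero b}} → t < ceilDiv (n + 1) b → t * b ≤ n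
<ceilDiv⇒*≤ n b t t<⌈n+1/b⌉ = +-cancelˡ-≤ b (t * b) n (subst (b + t * b ≤_) numerator suc-t-blocks)
  where
  suc-t-blocks : suc t * b ≤ n + 1 + (b ∸ 1)
  suc-t-blocks = ≤-trans (*-monoˡ-≤ b t<⌈n+1/b⌉) (m/n*n≤m (n + 1 + (b ∸ 1)) b)
  numerator : n + 1 + (b ∸ 1) ≡ b + n
  numerator = trans (+-assoc n 1 (b ∸ 1)) (trans (cong (n +_) (m+[n∸m]≡n (>-nonZero⁻¹ b))) (+-comm n b))

*≤⇒≤/ : (m a j : ℕ) .{{_ : NonZero a}} → m * a ≤ j → m ≤ j / a
*≤⇒≤/ m a j m*a≤j = subst (_≤ j / a) (m*n/n≡m m a) (/-monoˡ-≤ a m*a≤j)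

<∸⇒+< : ∀ m n o → m < o ∸ n → m + n < o
<∸⇒+< m zero    o       lt = subst (_< o) (sym (+-identityʳ m)) lt
<∸⇒+< m (suc n) (suc o) lt = subst (_< suc o) (sym (+-suc m n)) (s≤s (<∸⇒+< m n o lt))

+≤<⇒<∸ : ∀ {m n o p} → m + n ≤ o → o < p → n < p ∸ m
+≤<⇒<∸ {m} {n} {o} m+n≤o o<p = m+n≤o⇒m≤o∸n (suc n) (≤-trans (s≤s (subst (_≤ o) (+-comm m n) m+n≤o)) o<p)

staircase : (a b n : ℕ) .{{_ : NonZero a}} → ℕ → ℕ
staircase a b n j = (n + b) ∸ b * (j / a)

staircase-decreasing : (a b n : ℕ) .{{_ : NonZero a}} → WeaklyDecreasing (staircase a b n)
staircase-decreasing a b n j = ∸-monoʳ-≤ (n + b) (*-monoʳ-≤ b (/-monoˡ-≤ a (n≤1+n j)))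

staircase-finiteSupport : (a b n : ℕ) .{{_ : NonZero a}} .{{_ : NonZero b}} →
                          FiniteSupport (staircase a b n)
staircase-finiteSupport a b n = (n + b) * a , vanishes
  where
  vanishes : ∀ j → (n + b) * a ≤ j → staircase a b n j ≡ 0
  vanishes j late = m≤n⇒m∸n≡0 (≤-trans (*≤⇒≤/ (n + b) a j late) (m≤n*m (j / a) b))

staircase-low : (a b n t j : ℕ) .{{_ : NonZero a}} → suc t * a ≤ j → t * b ≤ n →
                staircase a b n j + t * b ≤ n
staircase-low a b n t j late t*b≤n = begin
    staircase a b n j + t * b  ≤⟨ +-monoˡ-≤ (t * b) (∸-monoʳ-≤ (n + b) (*-monoʳ-≤ b (*≤⇒≤/ (suc t) a j late))) ⟩
    (n + b) ∸ b * suc t + t * b ≡⟨ cong (_+ t * b) dropped ⟩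
    n ∸ t * b + t * b           ≡⟨ m∸n+n≡m t*b≤n ⟩
    n                           ∎
  where
  open ≤-Reasoning
  dropped : (n + b) ∸ b * suc t ≡ n ∸ t * b
  dropped = begin-equality
    (n + b) ∸ b * suc t   ≡⟨ cong ((n + b) ∸_) (*-suc b t) ⟩
    (n + b) ∸ (b + b * t) ≡⟨ sym (∸-+-assoc (n + b) b (b * t)) ⟩
    (n + b) ∸ b ∸ b * t   ≡⟨ cong₂ _∸_ (m+n∸n≡m n b) (*-comm b t) ⟩
    n ∸ t * b             ∎

staircase-high : (a b n j : ℕ) .{{_ : NonZero a}} → n + b ≤ staircase a b n j + b * (j / a)
staircase-high a b n j = subst (n + b ≤_) (+-comm (b * (j / a)) (staircase a b n j)) (m≤n+m∸n (n + b) (b * (j / a)))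

-- Weights a·x + b·y: shifting (i₀ , j₀) by (b , a) adds 2ab, which lifts a
-- point of weight ≥ (k-1)ab past kab.
shifted-weight : (k a b i₀ j₀ : ℕ) → 1 ≤ k → (k ∸ 1) * a * b ≤ a * i₀ + b * j₀ →
                 k * a * b ≤ a * (i₀ + b) + b * (j₀ + a)
shifted-weight (suc k) a b i₀ j₀ _ above = begin
    suc k * a * b                       ≡⟨ peel k a b ⟩
    k * a * b + a * b                   ≤⟨ +-mono-≤ above (m≤m+n (a * b) (a * b)) ⟩
    (a * i₀ + b * j₀) + (a * b + a * b) ≡⟨ shift a b i₀ j₀ ⟩
    a * (i₀ + b) + b * (j₀ + a)         ∎
  where
  open ≤-Reasoning
  peel : ∀ k a b → suc k * a * b ≡ k * a * b + a * b
  peel = solve-∀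
  shift : ∀ a b i₀ j₀ → (a * i₀ + b * j₀) + (a * b + a * b) ≡ a * (i₀ + b) + b * (j₀ + a)
  shift = solve-∀

block-weight : (a b i₀ j₀ u v R C : ℕ) → i₀ + b ≤ R + b * v → j₀ + a ≤ C + a * u →
               a * (i₀ + b) + b * (j₀ + a) ≤ a * (u * b + R) + b * (v * a + C)
block-weight a b i₀ j₀ u v R C i₀+b≤ j₀+a≤ = begin
    a * (i₀ + b) + b * (j₀ + a)       ≤⟨ +-mono-≤ (*-monoʳ-≤ a i₀+b≤) (*-monoʳ-≤ b j₀+a≤) ⟩
    a * (R + b * v) + b * (C + a * u) ≡⟨ regroup a b u v R C ⟩
    a * (u * b + R) + b * (v * a + C) ∎
  where
  open ≤-Reasoning
  regroup : ∀ a b u v R C → a * (R + b * v) + b * (C + a * u) ≡ a * (u * b + R) + b * (v * a + C)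
  regroup = solve-∀

-- Columns of A are rows of its transpose: ColAtLeast A = RowAtLeast (transpose A)
-- definitionally, so every counting lemma below serves for both.
transpose : Subset² → Subset²
transpose A i j = A j i

rowAtLeast-bounded : (A : Subset²) (j N m : ℕ) → (∀ i → A i j → i < N) → RowAtLeast A j m → m ≤ N
rowAtLeast-bounded A j N m left-of-N (f , f-injective , f∈A) = injective⇒≤ {f = g} g-injective
  where
  g : Fin m → Fin N
  g x = fromℕ< (left-of-N (f x) (f∈A x))
  g-injective : Injective _≡_ _≡_ g
  g-injective {x} {y} gx≡gy = f-injective (begin
    f x             ≡⟨ sym (toℕ-fromℕ< (left-of-N (f x) (f∈A x))) ⟩
    toℕ (g x)       ≡⟨ cong toℕ gx≡gy ⟩
    toℕ (g y)       ≡⟨ toℕ-fromℕ< (left-of-N (f y) (f∈A y)) ⟩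
    f y             ∎)
    where open ≡-Reasoning

rowAtLeast-filled : (A : Subset²) (j N m : ℕ) → (∀ i → i < N → A i j) → ¬ RowAtLeast A j m → N < m
rowAtLeast-filled A j N m filled few with m ≤? N
... | yes m≤N = ⊥-elim (few (toℕ , toℕ-injective , λ x → filled (toℕ x) (<-≤-trans (toℕ<n x) m≤N)))
... | no m≰N  = ≰⇒> m≰N

module StaircaseDynamics (I : List (ℕ × ℕ)) (a b i₀ j₀ : ℕ) .{{_ : NonZero a}} .{{_ : NonZero b}} where

  r c : ℕ → ℕ
  r = staircase a b i₀
  c = staircase b a j₀

  O : ℕ → Subset²
  O = Occ I r c

  LShape : ℕ → ℕ → ℕ → Set
  LShape t i j = i < t * b ⊎ j < t * a

  LShape-grows : ∀ t i j → LShape t i j → LShape (suc t) i j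
  LShape-grows t i j = [ (λ p → inj₁ (<-≤-trans p (m≤n+m (t * b) b))) , (λ q → inj₂ (<-≤-trans q (m≤n+m (t * a) a))) ]′

  -- A point beyond the L-shape of time t + 1 cannot be added at step t + 1:
  -- its row and column counts, shifted by the enhancements, still fall in the
  -- rectangle of Z containing (i₀ , j₀).
  blocked-outside : InZ I i₀ j₀ → ∀ t → t * b ≤ i₀ → t * a ≤ j₀ → (∀ i j → O t i j → LShape t i j) →
                    ∀ i j → suc t * b ≤ i → suc t * a ≤ j → EnInZ I r c (O t) i j
  blocked-outside z₀ t t*b≤i₀ t*a≤j₀ confined i j far-right far-up = Any.map block z₀
    where
    row-left : ∀ i′ → O t i′ j → i′ < t * b
    row-left i′ o = [ (λ p → p) , (λ q → ⊥-elim (<⇒≱ q (≤-trans (m≤n+m (t * a) a) far-up))) ]′ (confined i′ j o)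
    col-low : ∀ j′ → O t i j′ → j′ < t * a
    col-low j′ o = [ (λ p → ⊥-elim (<⇒≱ p (≤-trans (m≤n+m (t * b) b) far-right))) , (λ q → q) ]′ (confined i j′ o)
    block : ∀ {AB} → i₀ < proj₁ AB × j₀ < proj₂ AB →
            ¬ RowAtLeast (O t) j (proj₁ AB ∸ r j) × ¬ ColAtLeast (O t) i (proj₂ AB ∸ c i)
    block (i₀<A , j₀<B) =
      (λ row → <⇒≱ (+≤<⇒<∸ (staircase-low a b i₀ t j far-up t*b≤i₀) i₀<A)
                   (rowAtLeast-bounded (O t) j (t * b) _ row-left row)) ,
      (λ col → <⇒≱ (+≤<⇒<∸ (staircase-low b a j₀ t i far-right t*a≤j₀) j₀<B)
                   (rowAtLeast-bounded (transpose (O t)) i (t * a) _ col-low col))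

  confined : InZ I i₀ j₀ → ∀ t → t * b ≤ i₀ → t * a ≤ j₀ → ∀ i j → O t i j → LShape t i j
  confined z₀ zero    _     _     i j ()
  confined z₀ (suc t) t+1≤i₀ t+1≤j₀ i j o = step o
    where
    t*b≤i₀ : t * b ≤ i₀
    t*b≤i₀ = ≤-trans (m≤n+m (t * b) b) t+1≤i₀
    t*a≤j₀ : t * a ≤ j₀
    t*a≤j₀ = ≤-trans (m≤n+m (t * a) a) t+1≤j₀
    earlier : ∀ i j → O t i j → LShape t i j
    earlier = confined z₀ t t*b≤i₀ t*a≤j₀
    step : Ten I r c (O t) i j → LShape (suc t) i j
    step (inj₁ old) = LShape-grows t i j (earlier i j old)
    step (inj₂ new) with i <? suc t * b | j <? suc t * a
    ... | yes p | _     = inj₁ p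
    ... | no _  | yes q = inj₂ q
    ... | no p  | no q  = ⊥-elim (new (blocked-outside z₀ t t*b≤i₀ t*a≤j₀ earlier i j (≮⇒≥ p) (≮⇒≥ q)))

  not-full : InZ I i₀ j₀ → ∀ t → t * b ≤ i₀ → t * a ≤ j₀ → ¬ (∀ i j → O t i j)
  not-full z₀ t t*b≤i₀ t*a≤j₀ full =
    [ <-irrefl refl , <-irrefl refl ]′ (confined z₀ t t*b≤i₀ t*a≤j₀ (t * b) (t * a) (full _ _))

  filled : (K : ℕ) → (∀ i j → InZ I i j → a * i + b * j < K) → K ≤ a * (i₀ + b) + b * (j₀ + a) →
           ∀ t i j → i / b + j / a < t → O t i j
  filled K light heavy zero    i j ()
  filled K light heavy (suc t) i j level<t+1 = inj₂ (λ blocked → outside-Z (Any.map shift blocked))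
    where
    u v : ℕ
    u = i / b
    v = j / a
    level≤t : u + v ≤ t
    level≤t = s≤s⁻¹ level<t+1
    row-full : ∀ i′ → i′ < u * b → O t i′ j
    row-full i′ i′<ub = filled K light heavy t i′ j (<-≤-trans (+-monoˡ-< v (m<n*o⇒m/o<n i′<ub)) level≤t)
    col-full : ∀ j′ → j′ < v * a → O t i j′
    col-full j′ j′<va = filled K light heavy t i j′ (<-≤-trans (+-monoʳ-< u (m<n*o⇒m/o<n j′<va)) level≤t)
    shift : ∀ {AB} → ¬ RowAtLeast (O t) j (proj₁ AB ∸ r j) × ¬ ColAtLeast (O t) i (proj₂ AB ∸ c i) →
            u * b + r j < proj₁ AB × v * a + c i < proj₂ AB
    shift (few-row , few-col) =
      <∸⇒+< (u * b) (r j) _ (rowAtLeast-filled (O t) j (u * b) _ row-full few-row) ,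
      <∸⇒+< (v * a) (c i) _ (rowAtLeast-filled (transpose (O t)) i (v * a) _ col-full few-col)
    outside-Z : ¬ InZ I (u * b + r j) (v * a + c i)
    outside-Z inZ = <⇒≱ (light _ _ inZ)
      (≤-trans heavy (block-weight a b i₀ j₀ u v (r j) (c i) (staircase-high a b i₀ j) (staircase-high b a j₀ i)))

  spans : (K : ℕ) → (∀ i j → InZ I i j → a * i + b * j < K) → K ≤ a * (i₀ + b) + b * (j₀ + a) → Spans I r c
  spans K light heavy i j = suc (i / b + j / a) , filled K light heavy _ i j (n<1+n _)

lemma6p2 : (I : List (ℕ × ℕ)) → PositiveIndex I →
    (a b : ℕ) → .{{_ : NonZero a}} → .{{_ : NonZero b}} →
    (k : ℕ) → 1 ≤ k →
    (∀ i j → InZ I i j → a * i + b * j < k * a * b) →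
    (∀ k′ → 1 ≤ k′ → k′ < k → ¬ (∀ i j → InZ I i j → a * i + b * j < k′ * a * b)) →
    (i₀ j₀ : ℕ) → InZ I i₀ j₀ → (k ∸ 1) * a * b ≤ a * i₀ + b * j₀ →
    MuAtLeast I (ceilDiv (i₀ + 1) b ⊓ ceilDiv (j₀ + 1) a)
lemma6p2 I _ a b k 1≤k below-k _ i₀ j₀ z₀ above-k-1 =
  r , c ,
  staircase-decreasing a b i₀ , staircase-decreasing b a j₀ ,
  staircase-finiteSupport a b i₀ , staircase-finiteSupport b a j₀ ,
  spans (k * a * b) below-k (shifted-weight k a b i₀ j₀ 1≤k above-k-1) ,
  λ t _ t<M → not-full z₀ t
    (<ceilDiv⇒*≤ i₀ b t (m<n⊓o⇒m<n (ceilDiv (i₀ + 1) b) _ t<M))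
    (<ceilDiv⇒*≤ j₀ a t (m<n⊓o⇒m<o _ (ceilDiv (j₀ + 1) a) t<M))
  where open StaircaseDynamics I a b i₀ j₀
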